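{- Let $E$ be an algebraic number field of degree $n$ with ring of algebraic integers $R$, and let $\{\alpha_1,\dots,\alpha_n\}\subset R$ be an integral basis of $E/\mathbb{Q}$. Let $P_1,P_2$ be two distinct nonzero prime ideals of $R$ with $P_1\cap\mathbb{Z}=p\mathbb{Z}$ and $P_2\cap\mathbb{Z}=q\mathbb{Z}$, where $p$ and $q$ are distinct rational primes, and let $A=P_1P_2$. Put $$S_1=\Big\{\sum_{i=1}^n a_i\alpha_i \;\Big|\; a_i\in\mathbb{Z},\ 0\le a_i<pq,\ 1\le i\le n\Big\}.$$ Then every coset of $A$ in $R$ contains an element of $S_1$ (i.e. $S_1$ covers a set of coset representatives of $R/A$). Moreover, if the degrees of $P_1$ and $P_2$ are both $n$, then $S_1$ is exactly a set of coset representatives of $R/A$ (each coset contains exactly one element of $S_1$).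
   Context: For a nonzero prime ideal $P$ of $R$ with $P\cap\mathbb{Z}=p\mathbb{Z}$, the residue field $R/P$ has $p^f$ elements for some $1\le f\le n$; this $f$ is called the degree of $P$. -}

module Defs where

open import Level using (0ℓ)
open import Data.Nat as ℕ using (ℕ; _^_)
open import Data.Nat.Primality using (Prime)
open import Data.Integer as ℤ using (ℤ)
import Data.Integer.Divisibility as ℤDiv
open import Data.Rational as ℚ using (ℚ)
open import Data.Rational.Properties using (+-*-commutativeRing)
open import Data.Fin as Fin using (Fin; toℕ)
open import Data.Product using (Σ; ∃; _×_; _,_)
open import Data.Sum using (_⊎_)
open import Relation.Nullary using (¬_)
open import Relation.Binary.PropositionalEquality using (_≡_)
open import Function.Bundles using (_⇔_)
open import Algebra.Bundles using (CommutativeRing)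
open import Algebra.Morphism.Structures using (module RingMorphisms)

ℚ-ring : CommutativeRing 0ℓ 0ℓ
ℚ-ring = +-*-commutativeRing

module _ (A : CommutativeRing 0ℓ 0ℓ) where
  open CommutativeRing A using (Carrier; 0#; _+_)
  sumR : ∀ {m} → (Fin m → Carrier) → Carrier
  sumR {ℕ.zero}  f = 0#
  sumR {ℕ.suc m} f = f Fin.zero + sumR (λ i → f (Fin.suc i))

record NumberField (n : ℕ) : Set₁ where
  field
    E : CommutativeRing 0ℓ 0ℓ
  open CommutativeRing E public
  field
    0≉1     : ¬ (0# ≈ 1#)
    inverse : ∀ x → ¬ (x ≈ 0#) → ∃ λ y → x * y ≈ 1#
    ι       : ℚ → Carrier
    ι-hom   : RingMorphisms.IsRingHomomorphism
                (CommutativeRing.rawRing ℚ-ring) rawRing ι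
    ℚ-basis : Fin n → Carrier

  ∑ : ∀ {m} → (Fin m → Carrier) → Carrier
  ∑ = sumR E

  field
    ℚ-spans : ∀ x → ∃ λ (c : Fin n → ℚ) → x ≈ ∑ (λ i → ι (c i) * ℚ-basis i)
    ℚ-indep : ∀ (c d : Fin n → ℚ) →
              ∑ (λ i → ι (c i) * ℚ-basis i) ≈ ∑ (λ i → ι (d i) * ℚ-basis i) →
              ∀ i → c i ≡ d i

  ιℤ : ℤ → Carrier
  ιℤ k = ι (k ℚ./ 1)

  pow : Carrier → ℕ → Carrier
  pow x ℕ.zero    = 1#
  pow x (ℕ.suc k) = x * pow x k

  IsIntegral : Carrier → Set
  IsIntegral x = ∃ λ (d : ℕ) → ∃ λ (c : Fin d → ℤ) →
    pow x d + ∑ (λ (i : Fin d) → ιℤ (c i) * pow x (toℕ i)) ≈ 0#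


module _ {n : ℕ} (K : NumberField n) where
  open NumberField K

  lincomb : (Fin n → ℤ) → (Fin n → Carrier) → Carrier
  lincomb a α = ∑ (λ i → ιℤ (a i) * α i)

  record IsIntegralBasis (α : Fin n → Carrier) : Set where
    field
      integral : ∀ i → IsIntegral (α i)
      spans    : ∀ x → IsIntegral x → ∃ λ (a : Fin n → ℤ) → x ≈ lincomb a α
      unique   : ∀ (a b : Fin n → ℤ) → lincomb a α ≈ lincomb b α → ∀ i → a i ≡ b i

  -- ideals of R, represented as predicates on E contained in R
  record IsIdeal (I : Carrier → Set) : Set where
    field
      ⊆R    : ∀ {x} → I x → IsIntegral x
      resp  : ∀ {x y} → x ≈ y → I x → I y
      zero∈ : I 0#
      +∈    : ∀ {x y} → I x → I y → I (x + y)
      *∈    : ∀ {r x} → IsIntegral r → I x → I (r * x)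

  record IsNonzeroPrimeIdeal (P : Carrier → Set) : Set where
    field
      ideal   : IsIdeal P
      nonzero : ∃ λ x → P x × ¬ (x ≈ 0#)
      proper  : ¬ P 1#
      prime   : ∀ {a b} → IsIntegral a → IsIntegral b → P (a * b) → P a ⊎ P b

  LiesOver : (Carrier → Set) → ℕ → Set
  LiesOver P p = ∀ (k : ℤ) → P (ιℤ k) ⇔ (ℤ.+ p ℤDiv.∣ k)

  ProdIdeal : (Carrier → Set) → (Carrier → Set) → Carrier → Set
  ProdIdeal I J x = ∃ λ (m : ℕ) → ∃ λ (a : Fin m → Carrier) → ∃ λ (b : Fin m → Carrier) →
    (∀ i → I (a i)) × (∀ i → J (b i)) × (x ≈ ∑ (λ i → a i * b i))

  -- R/I has exactly N elements: there are N elements of R, pairwise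
  -- incongruent mod I, such that every element of R is congruent mod I to one of them
  ResidueCard : (Carrier → Set) → ℕ → Set
  ResidueCard I N = ∃ λ (r : Fin N → Carrier) →
    (∀ j → IsIntegral (r j)) ×
    (∀ x → IsIntegral x → ∃ λ j → I (x - r j)) ×
    (∀ j k → I (r j - r k) → j ≡ k)

  HasDegree : (Carrier → Set) → ℕ → ℕ → Set
  HasDegree P p f = ResidueCard P (p ^ f)

  InBox : ℕ → (Fin n → ℤ) → Set
  InBox N a = ∀ i → (ℤ.+ 0 ℤ.≤ a i) × (a i ℤ.< ℤ.+ N)

{-# OPTIONS --safe #-}
module Submission where

-- Reducing the integral coordinates of x modulo pq changes x by an element of pqR ⊆ P₁P₂.
-- For uniqueness, let P lie over r with |R/P| = r^n. Since rR ⊆ P, elements of R whose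
-- coordinates agree mod r are congruent mod P, so reading coordinates mod r is an injective
-- map from the r^n classes of R/P to (ℤ/r)^n, hence a bijection. Thus ∑ dᵢ αᵢ ∈ P forces r ∣ dᵢ.
-- Applied to P₁ and P₂ this gives pq ∣ aᵢ - bᵢ, and 0 ≤ aᵢ, bᵢ < pq forces aᵢ = bᵢ.

open import Defs
open import Level using (0ℓ)
open import Data.Nat as ℕ using (ℕ; suc)
import Data.Nat.Properties as ℕ
import Data.Nat.Divisibility as ℕ
import Data.Nat.Coprimality as ℕ
open import Data.Nat.Primality using (Prime; euclidsLemma; prime⇒irreducible; ¬prime[1]; prime⇒nonZero)
open import Data.Fin as Fin using (Fin; punchOut; funToFin; finToFun)
import Data.Fin.Properties as Fin
open import Data.Integer as ℤ using (ℤ; +_; -[1+_]; _%ℕ_; _/ℕ_)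
import Data.Integer.Properties as ℤ
import Data.Integer.DivMod as ℤ
import Data.Integer.Divisibility as ℤᵤ
open import Data.Integer.Divisibility.Signed as ℤˢ using (divides)
open import Data.Integer.Tactic.RingSolver using (solve-∀)
open import Data.Rational as ℚ using (ℚ; mkℚ)
import Data.Rational.Properties as ℚ
open import Data.Product using (∃; _×_; _,_; proj₁; proj₂)
open import Data.Sum using (inj₁; inj₂)
open import Data.Empty using (⊥-elim)
open import Relation.Nullary using (¬_; yes; no)
open import Relation.Binary.PropositionalEquality as ≡ using (_≡_; _≢_; cong; cong₂; subst; module ≡-Reasoning)
open import Function.Bundles using (_⇔_; Equivalence)
open import Algebra.Bundles using (CommutativeRing)
open import Algebra.Morphism.Structures using (module RingMorphisms)
import Algebra.Properties.AbelianGroup as AbelianGroupProperties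
import Algebra.Properties.CommutativeSemigroup as CommutativeSemigroupProperties
import Algebra.Properties.Ring as RingProperties
import Relation.Binary.Reasoning.Setoid as SetoidReasoning

injective⇒surjective : ∀ {N} (f : Fin N → Fin N) → (∀ {x y} → f x ≡ f y → x ≡ y) →
                       ∀ y → ∃ λ x → f x ≡ y
injective⇒surjective {suc N} f f-inj y with Fin.any? (λ x → f x Fin.≟ y)
... | yes hit = hit
... | no miss =
  let i , j , i<j , fi≡fj = Fin.pigeonhole (ℕ.n<1+n N) (λ x → punchOut (y≢f x))
  in ⊥-elim (Fin.<⇒≢ i<j (f-inj (Fin.punchOut-injective (y≢f i) (y≢f j) fi≡fj)))
  where
  y≢f : ∀ x → y ≢ f x
  y≢f x y≡fx = miss (x , ≡.sym y≡fx)

prime≢prime⇒*∣ : ∀ {p q m} → Prime p → Prime q → p ≢ q → p ℕ.∣ m → q ℕ.∣ m → p ℕ.* q ℕ.∣ m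
prime≢prime⇒*∣ {p} {q} p-prime q-prime p≢q p∣m (ℕ.divides s ≡.refl)
  with euclidsLemma s q p-prime p∣m
... | inj₁ p∣s = ℕ.*-monoˡ-∣ q p∣s
... | inj₂ p∣q with prime⇒irreducible q-prime p∣q
...   | inj₁ ≡.refl = ⊥-elim (¬prime[1] p-prime)
...   | inj₂ p≡q  = ⊥-elim (p≢q p≡q)

d∣n-n%ℕd : ∀ n d .{{_ : ℕ.NonZero d}} → + d ℤˢ.∣ n ℤ.- + (n %ℕ d)
d∣n-n%ℕd n d = divides (n /ℕ d) (begin
  n ℤ.- r                     ≡⟨ cong (ℤ._- r) (ℤ.a≡a%ℕn+[a/ℕn]*n n d) ⟩
  r ℤ.+ n /ℕ d ℤ.* + d ℤ.- r  ≡⟨ [r+s]-r≡s r (n /ℕ d ℤ.* + d) ⟩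
  n /ℕ d ℤ.* + d              ∎)
  where
  open ≡-Reasoning
  r : ℤ
  r = + (n %ℕ d)
  [r+s]-r≡s : ∀ r s → r ℤ.+ s ℤ.- r ≡ s
  [r+s]-r≡s = solve-∀

m%ℕd≡n%ℕd⇒d∣m-n : ∀ m n d .{{_ : ℕ.NonZero d}} → m %ℕ d ≡ n %ℕ d → + d ℤˢ.∣ m ℤ.- n
m%ℕd≡n%ℕd⇒d∣m-n m n d m%d≡n%d = subst (+ d ℤˢ.∣_) ([m-r]-[n-r]≡m-n m n (+ (n %ℕ d)))
  (ℤˢ.∣m∣n⇒∣m-n (subst (λ r → + d ℤˢ.∣ m ℤ.- + r) m%d≡n%d (d∣n-n%ℕd m d)) (d∣n-n%ℕd n d))
  where
  [m-r]-[n-r]≡m-n : ∀ m n r → (m ℤ.- r) ℤ.- (n ℤ.- r) ≡ m ℤ.- n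
  [m-r]-[n-r]≡m-n = solve-∀

N∣i-j⇒i≡j : ∀ {N i j} → (+ 0 ℤ.≤ i) × (i ℤ.< + N) → (+ 0 ℤ.≤ j) × (j ℤ.< + N) →
            + N ℤᵤ.∣ i ℤ.- j → i ≡ j
N∣i-j⇒i≡j {N} {+ u} {+ v} (_ , ℤ.+<+ u<N) (_ , ℤ.+<+ v<N) N∣u-v =
  ℤ.i-j≡0⇒i≡j (+ u) (+ v) (ℤ.∣i∣≡0⇒i≡0 (<∧∣⇒≡0 ∣u-v∣<N N∣u-v))
  where
  ∣u-v∣<N : ℤ.∣ + u ℤ.- + v ∣ ℕ.< N
  ∣u-v∣<N = ℕ.≤-<-trans
    (subst (λ k → ℤ.∣ k ∣ ℕ.≤ u ℕ.⊔ v) (≡.sym (ℤ.[+m]-[+n]≡m⊖n u v)) (ℤ.∣m⊝n∣≤m⊔n u v))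
    (ℕ.⊔-lub u<N v<N)
  <∧∣⇒≡0 : ∀ {D} → D ℕ.< N → N ℕ.∣ D → D ≡ 0
  <∧∣⇒≡0 {ℕ.zero}  _   _   = ≡.refl
  <∧∣⇒≡0 {suc D} D<N N∣D = ⊥-elim (ℕ.>⇒∤ D<N N∣D)

funToFin-injective : ∀ {m k} {f g : Fin m → Fin k} → funToFin f ≡ funToFin g → ∀ i → f i ≡ g i
funToFin-injective {f = f} {g} eq i = begin
  f i                     ≡⟨ Fin.finToFun-funToFin f i ⟨
  finToFun (funToFin f) i ≡⟨ cong (λ c → finToFun c i) eq ⟩
  finToFun (funToFin g) i ≡⟨ Fin.finToFun-funToFin g i ⟩
  g i                     ∎
  where open ≡-Reasoning

residue : ∀ r .{{_ : ℕ.NonZero r}} → ℤ → Fin r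
residue r k = Fin.fromℕ< (ℤ.n%ℕd<d k r)

residue-≡⇒∣ : ∀ {r} .{{_ : ℕ.NonZero r}} k l → residue r k ≡ residue r l → + r ℤˢ.∣ k ℤ.- l
residue-≡⇒∣ {r} k l eq = m%ℕd≡n%ℕd⇒d∣m-n k l r (begin
  k %ℕ r                ≡⟨ Fin.toℕ-fromℕ< (ℤ.n%ℕd<d k r) ⟨
  Fin.toℕ (residue r k) ≡⟨ cong Fin.toℕ eq ⟩
  Fin.toℕ (residue r l) ≡⟨ Fin.toℕ-fromℕ< (ℤ.n%ℕd<d l r) ⟩
  l %ℕ r                ∎)
  where open ≡-Reasoning

private
  -- i / 1 in normal form: ℚ's operations compute on it.
  ℤ→ℚ : ℤ → ℚ
  ℤ→ℚ i = mkℚ i 0 (ℕ.sym (ℕ.1-coprimeTo ℤ.∣ i ∣))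

  i/1≡ℤ→ℚ : ∀ i → i ℚ./ 1 ≡ ℤ→ℚ i
  i/1≡ℤ→ℚ i = ℚ.↥p/↧p≡p (ℤ→ℚ i)

/1-homo-+ : ∀ i j → (i ℤ.+ j) ℚ./ 1 ≡ (i ℚ./ 1) ℚ.+ (j ℚ./ 1)
/1-homo-+ i j rewrite i/1≡ℤ→ℚ i | i/1≡ℤ→ℚ j =
  cong (ℚ._/ 1) (≡.sym (cong₂ ℤ._+_ (ℤ.*-identityʳ i) (ℤ.*-identityʳ j)))

/1-homo-* : ∀ i j → (i ℤ.* j) ℚ./ 1 ≡ (i ℚ./ 1) ℚ.* (j ℚ./ 1)
/1-homo-* i j rewrite i/1≡ℤ→ℚ i | i/1≡ℤ→ℚ j = ≡.refl

/1-homo-neg : ∀ i → (ℤ.- i) ℚ./ 1 ≡ ℚ.- (i ℚ./ 1)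
/1-homo-neg i rewrite i/1≡ℤ→ℚ i | i/1≡ℤ→ℚ (ℤ.- i) = ℤ→ℚ-homo-neg i
  where
  ℤ→ℚ-homo-neg : ∀ i → ℤ→ℚ (ℤ.- i) ≡ ℚ.- ℤ→ℚ i
  ℤ→ℚ-homo-neg (+ 0)     = ≡.refl
  ℤ→ℚ-homo-neg (+ suc _) = ≡.refl
  ℤ→ℚ-homo-neg -[1+ _ ]  = ≡.refl

module _ (A : CommutativeRing 0ℓ 0ℓ) where
  open CommutativeRing A
  open AbelianGroupProperties +-abelianGroup using (⁻¹-∙-comm)
  open CommutativeSemigroupProperties +-commutativeSemigroup using (interchange)
  open SetoidReasoning setoid

  sumR-cong : ∀ {m} {f g : Fin m → Carrier} → (∀ i → f i ≈ g i) → sumR A f ≈ sumR A g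
  sumR-cong {ℕ.zero}  f≈g = refl
  sumR-cong {suc m} f≈g = +-cong (f≈g Fin.zero) (sumR-cong (λ i → f≈g (Fin.suc i)))

  sumR-sub : ∀ {m} (f g : Fin m → Carrier) → sumR A f - sumR A g ≈ sumR A (λ i → f i - g i)
  sumR-sub {ℕ.zero}  f g = -‿inverseʳ 0#
  sumR-sub {suc m} f g = begin
    (f₀ + F) - (g₀ + G)      ≈⟨ +-cong refl (sym (⁻¹-∙-comm g₀ G)) ⟩
    (f₀ + F) + (- g₀ + - G)  ≈⟨ interchange f₀ F (- g₀) (- G) ⟩
    (f₀ - g₀) + (F - G)      ≈⟨ +-cong refl (sumR-sub (λ i → f (Fin.suc i)) (λ i → g (Fin.suc i))) ⟩
    sumR A (λ i → f i - g i) ∎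
    where
    f₀ g₀ F G : Carrier
    f₀ = f Fin.zero
    g₀ = g Fin.zero
    F = sumR A (λ i → f (Fin.suc i))
    G = sumR A (λ i → g (Fin.suc i))

module _ {n : ℕ} (K : NumberField n) where
  open NumberField K
  open RingMorphisms.IsRingHomomorphism ι-hom using (+-homo; *-homo; -‿homo)
  open AbelianGroupProperties +-abelianGroup using (xyx⁻¹≈y)
  open CommutativeSemigroupProperties *-commutativeSemigroup using (xy∙z≈xz∙y)
  open RingProperties ring using ([y-z]x≈yx-zx)
  open SetoidReasoning setoid

  ιℤ-homo-+ : ∀ i j → ιℤ (i ℤ.+ j) ≈ ιℤ i + ιℤ j
  ιℤ-homo-+ i j = trans (reflexive (cong ι (/1-homo-+ i j))) (+-homo _ _)

  ιℤ-homo-* : ∀ i j → ιℤ (i ℤ.* j) ≈ ιℤ i * ιℤ j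
  ιℤ-homo-* i j = trans (reflexive (cong ι (/1-homo-* i j))) (*-homo _ _)

  ιℤ-homo-sub : ∀ i j → ιℤ (i ℤ.- j) ≈ ιℤ i - ιℤ j
  ιℤ-homo-sub i j = trans (ιℤ-homo-+ i (ℤ.- j))
    (+-cong refl (trans (reflexive (cong ι (/1-homo-neg j))) (-‿homo _)))

  lincomb-sub : ∀ a b (β : Fin n → Carrier) →
                lincomb K a β - lincomb K b β ≈ lincomb K (λ i → a i ℤ.- b i) β
  lincomb-sub a b β =
    trans (sumR-sub E (λ i → ιℤ (a i) * β i) (λ i → ιℤ (b i) * β i)) (sumR-cong E λ i → begin
    ιℤ (a i) * β i - ιℤ (b i) * β i  ≈⟨ [y-z]x≈yx-zx (β i) (ιℤ (a i)) (ιℤ (b i)) ⟨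
    (ιℤ (a i) - ιℤ (b i)) * β i      ≈⟨ *-cong (ιℤ-homo-sub (a i) (b i)) refl ⟨
    ιℤ (a i ℤ.- b i) * β i           ∎)

  module _ {I : Carrier → Set} (I-ideal : IsIdeal K I) where
    open IsIdeal I-ideal

    *∈ʳ : ∀ {r x} → IsIntegral r → I x → I (x * r)
    *∈ʳ r-integral x∈I = resp (*-comm _ _) (*∈ r-integral x∈I)

    ∑∈ : ∀ {m} (f : Fin m → Carrier) → (∀ i → I (f i)) → I (∑ f)
    ∑∈ {ℕ.zero}  f f∈I = zero∈
    ∑∈ {suc m} f f∈I = +∈ (f∈I Fin.zero) (∑∈ (λ i → f (Fin.suc i)) (λ i → f∈I (Fin.suc i)))

    sub∈⇒∈ : ∀ {x y} → I (x - y) → I y → I x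
    sub∈⇒∈ {x} {y} x-y∈I y∈I = resp y+[x-y]≈x (+∈ y∈I x-y∈I)
      where
      y+[x-y]≈x : y + (x - y) ≈ x
      y+[x-y]≈x = trans (sym (+-assoc y x (- y))) (xyx⁻¹≈y y x)

  ProdIdeal⊆ˡ : ∀ {I J} → IsIdeal K I → IsIdeal K J → ∀ {x} → ProdIdeal K I J x → I x
  ProdIdeal⊆ˡ I-ideal J-ideal (_ , a , b , a∈I , b∈J , x≈∑ab) = IsIdeal.resp I-ideal (sym x≈∑ab)
    (∑∈ I-ideal _ (λ i → *∈ʳ I-ideal (IsIdeal.⊆R J-ideal (b∈J i)) (a∈I i)))

  ProdIdeal⊆ʳ : ∀ {I J} → IsIdeal K I → IsIdeal K J → ∀ {x} → ProdIdeal K I J x → J x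
  ProdIdeal⊆ʳ I-ideal J-ideal (_ , a , b , a∈I , b∈J , x≈∑ab) = IsIdeal.resp J-ideal (sym x≈∑ab)
    (∑∈ J-ideal _ (λ i → IsIdeal.*∈ J-ideal (IsIdeal.⊆R I-ideal (a∈I i)) (b∈J i)))

  ιℤ∈ : ∀ {I r} → LiesOver K I r → ∀ {k} → + r ℤˢ.∣ k → I (ιℤ k)
  ιℤ∈ I-over-r {k} r∣k = Equivalence.from (I-over-r k) (ℤˢ.∣⇒∣ᵤ r∣k)

  module _ {α : Fin n → Carrier} (basis : IsIntegralBasis K α) where
    open IsIntegralBasis basis

    module _ {I : Carrier → Set} (I-ideal : IsIdeal K I) {r : ℕ} (I-over-r : LiesOver K I r) where
      open IsIdeal I-ideal

      lincomb∈ : ∀ e → (∀ i → + r ℤˢ.∣ e i) → I (lincomb K e α)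
      lincomb∈ e r∣e = ∑∈ I-ideal _ (λ i → *∈ʳ I-ideal (integral i) (ιℤ∈ {I} I-over-r (r∣e i)))

      lincomb-sub∈ : ∀ a b → (∀ i → + r ℤˢ.∣ a i ℤ.- b i) → I (lincomb K a α - lincomb K b α)
      lincomb-sub∈ a b r∣a-b = resp (sym (lincomb-sub a b α)) (lincomb∈ _ r∣a-b)

      module _ .{{_ : ℕ.NonZero r}} (I-degree : HasDegree K I r n) where

        private
          rep : Fin (r ℕ.^ n) → Carrier
          rep = proj₁ I-degree

          coords : Fin (r ℕ.^ n) → Fin n → ℤ
          coords j = proj₁ (spans (rep j) (proj₁ (proj₂ I-degree) j))

          rep≈lincomb : ∀ j → rep j ≈ lincomb K (coords j) α
          rep≈lincomb j = proj₂ (spans (rep j) (proj₁ (proj₂ I-degree) j))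

        rep-lincomb-injective : ∀ {j k} → I (lincomb K (coords j) α - lincomb K (coords k) α) → j ≡ k
        rep-lincomb-injective {j} {k} diff∈I = proj₂ (proj₂ (proj₂ I-degree)) j k
          (resp (+-cong (sym (rep≈lincomb j)) (-‿cong (sym (rep≈lincomb k)))) diff∈I)

        residues-surjective : ∀ (t : Fin n → Fin r) → ∃ λ j → ∀ i → residue r (coords j i) ≡ t i
        residues-surjective t =
          let j , code[j]≡t = injective⇒surjective code code-injective (funToFin t)
          in j , funToFin-injective code[j]≡t
          where
          code : Fin (r ℕ.^ n) → Fin (r ℕ.^ n)
          code j = funToFin (λ i → residue r (coords j i))

          code-injective : ∀ {j k} → code j ≡ code k → j ≡ k
          code-injective {j} {k} eq = rep-lincomb-injective (lincomb-sub∈ (coords j) (coords k)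
            (λ i → residue-≡⇒∣ (coords j i) (coords k i) (funToFin-injective eq i)))

        lincomb∈⇒∣ : ∀ d → I (lincomb K d α) → ∀ i → + r ℤˢ.∣ d i
        lincomb∈⇒∣ d d∈I = ∣d (residues-surjective (λ i → residue r (d i)))
                              (residues-surjective (λ _ → residue r (+ 0)))
          where
          ∣d : (∃ λ j → ∀ i → residue r (coords j i) ≡ residue r (d i)) →
               (∃ λ k → ∀ i → residue r (coords k i) ≡ residue r (+ 0)) →
               ∀ i → + r ℤˢ.∣ d i
          ∣d (j , cⱼ≡d) (k , cₖ≡0) i = subst (+ r ℤˢ.∣_) ([c-0]-[c-d]≡d (coords k i) (d i))
            (ℤˢ.∣m∣n⇒∣m-n (r∣cₖ i) (subst (λ l → + r ℤˢ.∣ coords l i ℤ.- d i) j≡k (r∣cⱼ-d i)))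
            where
            r∣cⱼ-d : ∀ i → + r ℤˢ.∣ coords j i ℤ.- d i
            r∣cⱼ-d i = residue-≡⇒∣ (coords j i) (d i) (cⱼ≡d i)
            r∣cₖ : ∀ i → + r ℤˢ.∣ coords k i ℤ.- + 0
            r∣cₖ i = residue-≡⇒∣ (coords k i) (+ 0) (cₖ≡0 i)
            [a-c]-[b-0]≡[a-b]-c : ∀ a b c → (a ℤ.- c) ℤ.- (b ℤ.- + 0) ≡ (a ℤ.- b) ℤ.- c
            [a-c]-[b-0]≡[a-b]-c = solve-∀
            r∣[cⱼ-cₖ]-d : ∀ i → + r ℤˢ.∣ (coords j i ℤ.- coords k i) ℤ.- d i
            r∣[cⱼ-cₖ]-d i = subst (+ r ℤˢ.∣_) ([a-c]-[b-0]≡[a-b]-c (coords j i) (coords k i) (d i))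
                              (ℤˢ.∣m∣n⇒∣m-n (r∣cⱼ-d i) (r∣cₖ i))
            j≡k : j ≡ k
            j≡k = rep-lincomb-injective (resp (sym (lincomb-sub (coords j) (coords k) α))
                    (sub∈⇒∈ I-ideal (lincomb-sub∈ (λ i → coords j i ℤ.- coords k i) d r∣[cⱼ-cₖ]-d) d∈I))
            [c-0]-[c-d]≡d : ∀ c d → (c ℤ.- + 0) ℤ.- (c ℤ.- d) ≡ d
            [c-0]-[c-d]≡d = solve-∀

    InBox-representative : ∀ {P₁ P₂ p q} → IsIdeal K P₁ → IsIdeal K P₂ →
      LiesOver K P₁ p → LiesOver K P₂ q → .{{_ : ℕ.NonZero (p ℕ.* q)}} →
      ∀ x → IsIntegral x → ∃ λ a → InBox K (p ℕ.* q) a × ProdIdeal K P₁ P₂ (x - lincomb K a α)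
    InBox-representative {P₁} {P₂} {p} {q} P₁-ideal P₂-ideal P₁-over-p P₂-over-q x x-integral =
      a , a∈box , (n , A , B , A∈P₁ , B∈P₂ , x-a≈∑AB)
      where
      c : Fin n → ℤ
      c = proj₁ (spans x x-integral)
      a : Fin n → ℤ
      a i = + (c i %ℕ (p ℕ.* q))
      a∈box : InBox K (p ℕ.* q) a
      a∈box i = ℤ.+≤+ ℕ.z≤n , ℤ.+<+ (ℤ.n%ℕd<d (c i) (p ℕ.* q))
      t : Fin n → ℤ
      t i = ℤˢ.quotient (d∣n-n%ℕd (c i) (p ℕ.* q))
      c-a≡tpq : ∀ i → c i ℤ.- a i ≡ (t i ℤ.* + p) ℤ.* + q
      c-a≡tpq i = ≡.trans (ℤˢ._∣_.equality (d∣n-n%ℕd (c i) (p ℕ.* q)))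
                    (≡.trans (cong (t i ℤ.*_) (ℤ.pos-* p q)) (≡.sym (ℤ.*-assoc (t i) (+ p) (+ q))))
      A B : Fin n → Carrier
      A i = ιℤ (t i ℤ.* + p) * α i
      B i = ιℤ (+ q)
      A∈P₁ : ∀ i → P₁ (A i)
      A∈P₁ i = *∈ʳ P₁-ideal (integral i) (ιℤ∈ {P₁} P₁-over-p (divides (t i) ≡.refl))
      B∈P₂ : ∀ i → P₂ (B i)
      B∈P₂ i = ιℤ∈ {P₂} P₂-over-q (divides (+ 1) (≡.sym (ℤ.*-identityˡ (+ q))))
      x-a≈∑AB : x - lincomb K a α ≈ ∑ (λ i → A i * B i)
      x-a≈∑AB = begin
        x - lincomb K a α                ≈⟨ +-cong (proj₂ (spans x x-integral)) refl ⟩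
        lincomb K c α - lincomb K a α    ≈⟨ lincomb-sub c a α ⟩
        lincomb K (λ i → c i ℤ.- a i) α  ≈⟨ sumR-cong E (λ i → begin
          ιℤ (c i ℤ.- a i) * α i                 ≈⟨ *-cong (reflexive (cong ιℤ (c-a≡tpq i))) refl ⟩
          ιℤ ((t i ℤ.* + p) ℤ.* + q) * α i       ≈⟨ *-cong (ιℤ-homo-* (t i ℤ.* + p) (+ q)) refl ⟩
          (ιℤ (t i ℤ.* + p) * ιℤ (+ q)) * α i    ≈⟨ xy∙z≈xz∙y _ _ _ ⟩
          A i * B i                              ∎) ⟩
        ∑ (λ i → A i * B i)              ∎

    InBox-unique : ∀ {P₁ P₂ p q} → IsIdeal K P₁ → IsIdeal K P₂ →
      Prime p → Prime q → p ≢ q → LiesOver K P₁ p → LiesOver K P₂ q →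
      HasDegree K P₁ p n → HasDegree K P₂ q n →
      ∀ a b → InBox K (p ℕ.* q) a → InBox K (p ℕ.* q) b →
      ProdIdeal K P₁ P₂ (lincomb K a α - lincomb K b α) → ∀ i → a i ≡ b i
    InBox-unique {P₁} {P₂} P₁-ideal P₂-ideal p-prime q-prime p≢q P₁-over-p P₂-over-q P₁-degree P₂-degree
                 a b a∈box b∈box a-b∈P₁P₂ i =
      N∣i-j⇒i≡j (a∈box i) (b∈box i)
        (prime≢prime⇒*∣ p-prime q-prime p≢q (ℤˢ.∣⇒∣ᵤ (p∣a-b i)) (ℤˢ.∣⇒∣ᵤ (q∣a-b i)))
      where
      a-b : Fin n → ℤ
      a-b i = a i ℤ.- b i
      p∣a-b : ∀ i → + _ ℤˢ.∣ a-b i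
      p∣a-b = lincomb∈⇒∣ P₁-ideal P₁-over-p {{prime⇒nonZero p-prime}} P₁-degree a-b
        (IsIdeal.resp P₁-ideal (lincomb-sub a b α) (ProdIdeal⊆ˡ P₁-ideal P₂-ideal a-b∈P₁P₂))
      q∣a-b : ∀ i → + _ ℤˢ.∣ a-b i
      q∣a-b = lincomb∈⇒∣ P₂-ideal P₂-over-q {{prime⇒nonZero q-prime}} P₂-degree a-b
        (IsIdeal.resp P₂-ideal (lincomb-sub a b α) (ProdIdeal⊆ʳ P₁-ideal P₂-ideal a-b∈P₁P₂))

open import Data.Nat using (_*_)

lemma1p1 : (n : ℕ) (K : NumberField n) (α : Fin n → NumberField.Carrier K) →
    IsIntegralBasis K α →
    (P₁ P₂ : NumberField.Carrier K → Set) →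
    IsNonzeroPrimeIdeal K P₁ → IsNonzeroPrimeIdeal K P₂ →
    ¬ (∀ x → P₁ x ⇔ P₂ x) →
    (p q : ℕ) → Prime p → Prime q → p ≢ q →
    LiesOver K P₁ p → LiesOver K P₂ q →
    ((x : NumberField.Carrier K) → NumberField.IsIntegral K x →
       ∃ λ (a : Fin n → ℤ) → InBox K (p * q) a ×
         ProdIdeal K P₁ P₂ (NumberField._-_ K x (lincomb K a α)))
    ×
    (HasDegree K P₁ p n → HasDegree K P₂ q n →
       (a b : Fin n → ℤ) → InBox K (p * q) a → InBox K (p * q) b →
       ProdIdeal K P₁ P₂ (NumberField._-_ K (lincomb K a α) (lincomb K b α)) →
       ∀ i → a i ≡ b i)
lemma1p1 n K α basis P₁ P₂ P₁-prime P₂-prime _ p q p-prime q-prime p≢q P₁-over-p P₂-over-q =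
  InBox-representative K basis P₁-ideal P₂-ideal P₁-over-p P₂-over-q {{pq≢0}} ,
  InBox-unique K basis P₁-ideal P₂-ideal p-prime q-prime p≢q P₁-over-p P₂-over-q
  where
  P₁-ideal : IsIdeal K P₁
  P₁-ideal = IsNonzeroPrimeIdeal.ideal P₁-prime
  P₂-ideal : IsIdeal K P₂
  P₂-ideal = IsNonzeroPrimeIdeal.ideal P₂-prime
  pq≢0 : ℕ.NonZero (p * q)
  pq≢0 = ℕ.m*n≢0 p q {{prime⇒nonZero p-prime}} {{prime⇒nonZero q-prime}}
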